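{- Let $a_k$ denote the number of nonempty $\otimes$-irreducible partition diagrams in $A_k$, for $k \geq 1$, and let $B_m$ be the $m$-th Bell number. Then, as formal power series, $$\sum_{k=1}^{\infty} a_k x^k = 1 - \frac{1}{1 + \sum_{k=1}^{\infty} B_{2k} x^k}.$$
   Context: For $k \geq 0$, a partition diagram of order $k$ is a set partition of $\{1,\ldots,k,1',\ldots,k'\}$; $A_k$ denotes the set of such diagrams. For $\pi \in A_k$ and $\rho \in A_l$, $\pi \otimes \rho \in A_{k+l}$ is the set partition whose blocks are the blocks of $\pi$ together with the blocks of $\rho$ with every $i$ replaced by $i+k$ and every $i'$ by $(i+k)'$. A diagram is $\otimes$-irreducible if it cannot be written as $\rho^{(1)} \otimes \rho^{(2)}$ with $\rho^{(1)},\rho^{(2)}$ nonempty (of positive order). -}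

module Defs where

open import Data.Nat using (ℕ; zero; suc; _+_; _*_; _∸_; _≤_)
open import Data.Integer as ℤ using (ℤ)
open import Data.Bool using (Bool; true; false)
open import Data.Fin using (Fin; splitAt; _↑ˡ_; _↑ʳ_)
open import Data.Sum using (_⊎_; inj₁; inj₂)
open import Data.Product using (Σ; ∃; _×_; _,_)
open import Data.Vec using (Vec; lookup; tabulate)
open import Data.List using (List; length; map; foldr; upTo)
open import Data.List.Membership.Propositional using (_∈_)
open import Data.List.Relation.Unary.Unique.Propositional using (Unique)
open import Function.Bundles using (_⇔_)
open import Relation.Binary.PropositionalEquality using (_≡_; subst)
open import Relation.Nullary using (¬_)

-- Finite binary relations on Fin n, stored as Boolean matrices
-- (so that propositional equality is structural).

Rel : ℕ → Set
Rel n = Vec (Vec Bool n) n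

rel : ∀ {n} → Rel n → Fin n → Fin n → Bool
rel R i j = lookup (lookup R i) j

-- A set partition of Fin n, given as its equivalence relation
-- ("i and j lie in the same block").
IsSetPartition : ∀ {n} → Rel n → Set
IsSetPartition {n} R =
  (∀ i → rel R i i ≡ true) ×
  (∀ i j → rel R i j ≡ true → rel R j i ≡ true) ×
  (∀ i j l → rel R i j ≡ true → rel R j l ≡ true → rel R i l ≡ true)

NumberOf : ∀ {n} → (Rel n → Set) → ℕ → Set
NumberOf {n} P c =
  Σ (List (Rel n)) λ xs → Unique xs × (∀ R → (R ∈ xs) ⇔ P R) × length xs ≡ c

-- Partition diagrams of order k: set partitions of {1..k,1'..k'},
-- encoded on Fin (k + k): i ↑ˡ k  is the point i+1,  k ↑ʳ i  is (i+1)'.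

Diag : ℕ → Set
Diag k = Rel (k + k)

IsDiagram : ∀ k → Diag k → Set
IsDiagram k π = IsSetPartition π

-- side (true = top row, false = bottom row) and column of a point
side : ∀ {k} → Fin (k + k) → Bool × Fin k
side {k} p with splitAt k p
... | inj₁ i = true , i
... | inj₂ i = false , i

point : ∀ {k} → Bool → Fin k → Fin (k + k)
point {k} true  i = i ↑ˡ k
point {k} false i = k ↑ʳ i

tensorRel : ∀ {k l} → Diag k → Diag l → Fin ((k + l) + (k + l)) → Fin ((k + l) + (k + l)) → Bool
tensorRel {k} {l} π ρ p q with side {k + l} p | side {k + l} q
... | (s , c) | (t , d) with splitAt k c | splitAt k d
...   | inj₁ c₁ | inj₁ d₁ = rel π (point s c₁) (point t d₁)
...   | inj₂ c₂ | inj₂ d₂ = rel ρ (point s c₂) (point t d₂)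
...   | inj₁ _  | inj₂ _  = false
...   | inj₂ _  | inj₁ _  = false

_⊗_ : ∀ {k l} → Diag k → Diag l → Diag (k + l)
_⊗_ {k} {l} π ρ = tabulate λ p → tabulate λ q → tensorRel {k} {l} π ρ p q

Irreducible : ∀ k → Diag k → Set
Irreducible k π =
  ¬ (Σ ℕ λ k₁ → Σ ℕ λ k₂ → Σ (k₁ + k₂ ≡ k) λ e →
       Σ (Diag k₁) λ ρ₁ → Σ (Diag k₂) λ ρ₂ →
         1 ≤ k₁ × 1 ≤ k₂ × IsDiagram k₁ ρ₁ × IsDiagram k₂ ρ₂ ×
         subst Diag e (_⊗_ {k₁} {k₂} ρ₁ ρ₂) ≡ π)

Series : Set
Series = ℕ → ℤ

_⋆_ : Series → Series → Series
(f ⋆ g) n = foldr ℤ._+_ ℤ.0ℤ (map (λ i → f i ℤ.* g (n ∸ i)) (upTo (suc n)))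

oneS : Series
oneS zero    = ℤ.1ℤ
oneS (suc _) = ℤ.0ℤ

irredSeries : (ℕ → ℕ) → Series
irredSeries a zero    = ℤ.0ℤ
irredSeries a (suc k) = ℤ.+ a (suc k)

bellSeries : (ℕ → ℕ) → Series
bellSeries B zero    = ℤ.1ℤ
bellSeries B (suc k) = ℤ.+ B (2 * suc k)

{-# OPTIONS --safe #-}
-- Call j (0 < j < n) a split point of π ∈ A_n if no block of π meets both the columns < j and the
-- columns ≥ j; π splits at j exactly when π = ρ₁ ⊗ ρ₂ with ρ₁ of order j, so π is ⊗-irreducible
-- iff it has no split point.  If j is the least split point of π, then in π = ρ₁ ⊗ ρ₂ the factor
-- ρ₁ is irreducible, and conversely an irreducible left factor of order j makes j the least split
-- point.  Sorting the B_{2n} diagrams of A_n by this first factor gives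
--   B_{2n} = a_n + Σ_{0<j<n} a_j B_{2(n-j)},
-- i.e. b = 1 + A ⋆ b for b = 1 + Σ B_{2k} x^k and A = Σ a_k x^k.  Hence (1 - A) ⋆ b = 1, and since
-- b₀ = 1 makes b cancellable, every G with G ⋆ b = 1 equals 1 - A.
module Submission where

open import Defs
open import Data.Nat as ℕ using (ℕ; zero; suc; _∸_; _≤_; _<_; z≤n; s≤s; _<?_; _≤?_)
open import Data.Nat.Properties as ℕ
  using (+-0-monoid; m≤m+n; m<m+n; m+n≮m; ≤⇒≯; <-≤-trans; <⇒≤; m+[n∸m]≡n; m<n⇒0<n∸m; <-cmp)
open import Data.Integer using (_-_)
open import Data.Bool using (Bool; true; false)
import Data.Bool.Properties as Bool
open import Data.Fin as Fin using (Fin; toℕ; fromℕ<; splitAt; _↑ˡ_; _↑ʳ_)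
open import Data.Fin.Properties
  using (⊎⇔∃; suc-injective; toℕ-injective; all?; any?; ¬∀⟶∃¬-smallest; toℕ-inject; toℕ-fromℕ<;
         splitAt-↑ˡ; splitAt-↑ʳ; splitAt⁻¹-↑ˡ; splitAt⁻¹-↑ʳ; toℕ-↑ˡ; toℕ-↑ʳ; toℕ<n)
open import Data.Vec using (lookup; tabulate)
open import Data.Vec.Properties using (lookup∘tabulate; tabulate∘lookup; tabulate-cong)
open import Data.Product using (Σ; ∃; _×_; _,_; proj₁; proj₂; uncurry)
open import Data.Sum as Sum using (_⊎_; inj₁; inj₂)
open import Data.List using (List; []; _∷_; map; _++_; length; cartesianProduct)
open import Data.List.Properties using (length-map; length-++)
open import Data.List.Membership.Propositional using (_∈_)
open import Data.List.Membership.Propositional.Properties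
  using (∈-map⁺; ∈-map⁻; ∈-++⁺ˡ; ∈-++⁺ʳ; ∈-++⁻; ∈-cartesianProduct⁺; ∈-cartesianProduct⁻)
open import Data.List.Membership.Propositional.Properties.WithK using (unique∧set⇒bag)
open import Data.List.Relation.Binary.BagAndSetEquality using (∼bag⇒↭)
open import Data.List.Relation.Binary.Permutation.Propositional.Properties using (↭-length)
open import Data.List.Relation.Unary.AllPairs using ([])
open import Data.List.Relation.Unary.Unique.Propositional using (Unique)
open import Data.List.Relation.Unary.Unique.Propositional.Properties using (map⁺; ++⁺; cartesianProduct⁺)
open import Function using (_∘_; case_of_)
open import Function.Bundles using (_⇔_; mk⇔; Equivalence)
import Function.Properties.Equivalence as ⇔
open import Relation.Binary.Definitions using (tri<; tri≈; tri>)
open import Relation.Binary.PropositionalEquality as ≡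
open import Relation.Nullary using (¬_; contradiction; Dec; yes; no; ¬?)
open import Relation.Nullary.Decidable using (map′; _×-dec_; _→-dec_; decidable-stable)
open import Algebra.Properties.Monoid.Sum +-0-monoid using (sum)

module PowerSeries where

  open import Data.Nat.Properties using (n∸n≡0)
  open import Data.Nat.Induction using (<-rec)
  open import Data.Fin using (fromℕ; inject₁)
  open import Data.Fin.Properties using (toℕ-inject₁; toℕ-fromℕ)
  open import Data.List using (foldr; applyUpTo)
  open import Data.Integer as ℤ using (ℤ; +_; 0ℤ; 1ℤ; _+_; _*_)
  import Data.Integer.Properties as ℤ
  open import Data.Integer.Tactic.RingSolver using (solve-∀)
  open import Algebra.Bundles using (AbelianGroup)
  open import Algebra.Properties.Monoid.Sum ℤ.+-0-monoid
    using (sum-syntax; sum-cong-≗; sum-init-last; sum-replicate-zero)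
  open import Algebra.Properties.Group (AbelianGroup.group ℤ.+-0-abelianGroup) using (∙-cancelˡ)

  foldr-applyUpTo : (h : ℕ → ℤ) (f : ℕ → ℕ) (t : ℕ) →
    foldr _+_ 0ℤ (map h (applyUpTo f t)) ≡ ∑[ i < t ] h (f (toℕ i))
  foldr-applyUpTo h f zero    = refl
  foldr-applyUpTo h f (suc t) = cong (λ s → h (f 0) + s) (foldr-applyUpTo h (f ∘ suc) t)

  ⋆-as-∑ : (f g : Series) (n : ℕ) → (f ⋆ g) n ≡ ∑[ i < suc n ] (f (toℕ i) * g (n ∸ toℕ i))
  ⋆-as-∑ f g n = foldr-applyUpTo (λ i → f i * g (n ∸ i)) (λ i → i) (suc n)

  ∑-init-last : (h : ℕ → ℤ) (n : ℕ) → ∑[ i < suc n ] h (toℕ i) ≡ ∑[ i < n ] h (toℕ i) + h n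
  ∑-init-last h n = begin
    ∑[ i < suc n ] h (toℕ i)                           ≡⟨ sum-init-last {n} (h ∘ toℕ) ⟩
    ∑[ i < n ] h (toℕ (inject₁ i)) + h (toℕ (fromℕ n)) ≡⟨ cong₂ _+_ (sum-cong-≗ {n} (cong h ∘ toℕ-inject₁))
                                                                   (cong h (toℕ-fromℕ n)) ⟩
    ∑[ i < n ] h (toℕ i) + h n                         ∎
    where open ≡-Reasoning

  pos-sum : ∀ {n} (f : Fin n → ℕ) → + sum f ≡ ∑[ i < n ] (+ f i)
  pos-sum {zero}  f = refl
  pos-sum {suc n} f = trans (ℤ.pos-+ (f Fin.zero) (sum (f ∘ Fin.suc)))
                            (cong (λ s → + f Fin.zero + s) (pos-sum (f ∘ Fin.suc)))

  ∑-distrib-minus : ∀ {n} (f h : Fin n → ℤ) → ∑[ i < n ] (f i - h i) ≡ ∑[ i < n ] f i - ∑[ i < n ] h i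
  ∑-distrib-minus {zero}  f h = refl
  ∑-distrib-minus {suc n} f h =
    trans (cong (λ s → f Fin.zero - h Fin.zero + s) (∑-distrib-minus (f ∘ Fin.suc) (h ∘ Fin.suc)))
          (interchange (f Fin.zero) (h Fin.zero) _ _)
    where
    interchange : ∀ w x y z → (w - x) + (y - z) ≡ (w + y) - (x + z)
    interchange = solve-∀

  ⋆-init-last : (f g : Series) (n : ℕ) → (f ⋆ g) n ≡ ∑[ i < n ] (f (toℕ i) * g (n ∸ toℕ i)) + f n * g 0
  ⋆-init-last f g n = begin
    (f ⋆ g) n                                  ≡⟨ ⋆-as-∑ f g n ⟩
    ∑[ i < suc n ] (f (toℕ i) * g (n ∸ toℕ i)) ≡⟨ ∑-init-last (λ i → f i * g (n ∸ i)) n ⟩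
    earlier + f n * g (n ∸ n)                  ≡⟨ cong (λ m → earlier + f n * g m) (n∸n≡0 n) ⟩
    earlier + f n * g 0                        ∎
    where
    open ≡-Reasoning
    earlier : ℤ
    earlier = ∑[ i < n ] (f (toℕ i) * g (n ∸ toℕ i))

  ⋆-cancelʳ : {f h g : Series} → g 0 ≡ 1ℤ → (∀ n → (f ⋆ g) n ≡ (h ⋆ g) n) → ∀ n → f n ≡ h n
  ⋆-cancelʳ {f} {h} {g} g₀≡1 f⋆g≡h⋆g = <-rec _ step
    where
    step : ∀ n → (∀ {m} → m < n → f m ≡ h m) → f n ≡ h n
    step n f≡h-below = begin
      f n         ≡⟨ ℤ.*-identityʳ (f n) ⟨
      f n * 1ℤ    ≡⟨ cong (f n *_) g₀≡1 ⟨
      f n * g 0   ≡⟨ ∙-cancelˡ earlierₕ _ _ last-terms ⟩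
      h n * g 0   ≡⟨ cong (h n *_) g₀≡1 ⟩
      h n * 1ℤ    ≡⟨ ℤ.*-identityʳ (h n) ⟩
      h n         ∎
      where
      open ≡-Reasoning
      earlierₕ : ℤ
      earlierₕ = ∑[ i < n ] (h (toℕ i) * g (n ∸ toℕ i))
      earlier-terms : ∑[ i < n ] (f (toℕ i) * g (n ∸ toℕ i)) ≡ earlierₕ
      earlier-terms = sum-cong-≗ λ i → cong (_* g (n ∸ toℕ i)) (f≡h-below (toℕ<n i))
      last-terms : earlierₕ + f n * g 0 ≡ earlierₕ + h n * g 0
      last-terms = begin
        earlierₕ + f n * g 0                               ≡⟨ cong (λ s → s + f n * g 0) earlier-terms ⟨
        ∑[ i < n ] (f (toℕ i) * g (n ∸ toℕ i)) + f n * g 0 ≡⟨ ⋆-init-last f g n ⟨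
        (f ⋆ g) n                                          ≡⟨ f⋆g≡h⋆g n ⟩
        (h ⋆ g) n                                          ≡⟨ ⋆-init-last h g n ⟩
        earlierₕ + h n * g 0                               ∎

  ⋆-identityˡ : (g : Series) (n : ℕ) → (oneS ⋆ g) n ≡ g n
  ⋆-identityˡ g n = begin
    (oneS ⋆ g) n               ≡⟨ ⋆-as-∑ oneS g n ⟩
    1ℤ * g n + ∑[ i < n ] 0ℤ   ≡⟨ cong₂ _+_ (ℤ.*-identityˡ (g n)) (sum-replicate-zero n) ⟩
    g n + 0ℤ                   ≡⟨ ℤ.+-identityʳ (g n) ⟩
    g n                        ∎
    where open ≡-Reasoning

  ⋆-distribʳ-minus : (f h g : Series) (n : ℕ) → ((λ i → f i - h i) ⋆ g) n ≡ (f ⋆ g) n - (h ⋆ g) n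
  ⋆-distribʳ-minus f h g n = begin
    ((λ i → f i - h i) ⋆ g) n                                ≡⟨ ⋆-as-∑ (λ i → f i - h i) g n ⟩
    ∑[ i < suc n ] ((f (toℕ i) - h (toℕ i)) * g (n ∸ toℕ i)) ≡⟨ sum-cong-≗ {suc n} (λ i →
                                                                  distrib (f (toℕ i)) (h (toℕ i)) (g (n ∸ toℕ i))) ⟩
    ∑[ i < suc n ] (F i - H i)                               ≡⟨ ∑-distrib-minus F H ⟩
    ∑[ i < suc n ] F i - ∑[ i < suc n ] H i                  ≡⟨ cong₂ _-_ (⋆-as-∑ f g n) (⋆-as-∑ h g n) ⟨
    (f ⋆ g) n - (h ⋆ g) n                                    ∎
    where
    open ≡-Reasoning
    F H : Fin (suc n) → ℤ
    F i = f (toℕ i) * g (n ∸ toℕ i)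
    H i = h (toℕ i) * g (n ∸ toℕ i)
    distrib : ∀ x y z → (x - y) * z ≡ x * z - y * z
    distrib = solve-∀

  geometric-⋆-inverse : (A b : Series) → A 0 ≡ 0ℤ → b 0 ≡ 1ℤ → (∀ n → b (suc n) ≡ (A ⋆ b) (suc n)) →
    ∀ n → ((λ i → oneS i - A i) ⋆ b) n ≡ oneS n
  geometric-⋆-inverse A b A₀≡0 b₀≡1 b≡A⋆b n = begin
    ((λ i → oneS i - A i) ⋆ b) n   ≡⟨ ⋆-distribʳ-minus oneS A b n ⟩
    (oneS ⋆ b) n - (A ⋆ b) n       ≡⟨ cong (λ x → x - (A ⋆ b) n) (⋆-identityˡ b n) ⟩
    b n - (A ⋆ b) n                ≡⟨ b-A⋆b n ⟩
    oneS n                         ∎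
    where
    open ≡-Reasoning
    b-A⋆b : ∀ n → b n - (A ⋆ b) n ≡ oneS n
    b-A⋆b zero    rewrite A₀≡0 | b₀≡1 = refl
    b-A⋆b (suc n) = trans (cong (λ x → x - (A ⋆ b) (suc n)) (b≡A⋆b n)) (ℤ.+-inverseʳ ((A ⋆ b) (suc n)))

  geometric-inverse-unique : (A b G : Series) → A 0 ≡ 0ℤ → b 0 ≡ 1ℤ →
    (∀ n → b (suc n) ≡ (A ⋆ b) (suc n)) → (∀ n → (G ⋆ b) n ≡ oneS n) → ∀ n → A n ≡ oneS n - G n
  geometric-inverse-unique A b G A₀≡0 b₀≡1 b≡A⋆b G⋆b≡1 n = begin
    A n                        ≡⟨ cancel (oneS n) (A n) ⟩
    oneS n - (oneS n - A n)    ≡⟨ cong (λ x → oneS n - x) (G≗1-A n) ⟨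
    oneS n - G n               ∎
    where
    open ≡-Reasoning
    cancel : ∀ x y → y ≡ x - (x - y)
    cancel = solve-∀
    G≗1-A : ∀ n → G n ≡ oneS n - A n
    G≗1-A = ⋆-cancelʳ b₀≡1 λ m → trans (G⋆b≡1 m) (sym (geometric-⋆-inverse A b A₀≡0 b₀≡1 b≡A⋆b m))

  bellSeries-pos : (B : ℕ → ℕ) → ∀ {m} → 0 < m → bellSeries B m ≡ + B (m ℕ.+ m)
  bellSeries-pos B {suc m} _ = cong (λ k → + B (suc m ℕ.+ k)) (ℕ.+-identityʳ (suc m))

  bellSeries-recurrence : {a B : ℕ → ℕ} →
    (∀ n → B (suc n ℕ.+ suc n) ≡
             a (suc n) ℕ.+ sum (λ (i : Fin n) → a (suc (toℕ i)) ℕ.* B ((n ∸ toℕ i) ℕ.+ (n ∸ toℕ i)))) →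
    ∀ n → bellSeries B (suc n) ≡ (irredSeries a ⋆ bellSeries B) (suc n)
  bellSeries-recurrence {a} {B} recurrence n = sym (begin
    (irredSeries a ⋆ bellSeries B) (suc n)               ≡⟨ ⋆-as-∑ (irredSeries a) (bellSeries B) (suc n) ⟩
    0ℤ * bellSeries B (suc n) + ∑[ i < suc n ] T (toℕ i) ≡⟨ ℤ.+-identityˡ _ ⟩
    ∑[ i < suc n ] T (toℕ i)                             ≡⟨ ∑-init-last T n ⟩
    ∑[ i < n ] T (toℕ i) + T n                           ≡⟨ cong₂ _+_ (sum-cong-≗ {n} (earlier-term ∘ toℕ<n)) last-term ⟩
    ∑[ i < n ] (+ C i) + + a (suc n)                     ≡⟨ cong (λ s → s + + a (suc n)) (pos-sum C) ⟨
    + sum C + + a (suc n)                                ≡⟨ ℤ.pos-+ (sum C) (a (suc n)) ⟨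
    + (sum C ℕ.+ a (suc n))                              ≡⟨ cong +_ (ℕ.+-comm (sum C) (a (suc n))) ⟩
    + (a (suc n) ℕ.+ sum C)                              ≡⟨ cong +_ (recurrence n) ⟨
    + B (suc n ℕ.+ suc n)                                ≡⟨ bellSeries-pos B (s≤s z≤n) ⟨
    bellSeries B (suc n)                                 ∎)
    where
    open ≡-Reasoning
    T : ℕ → ℤ
    T m = + a (suc m) * bellSeries B (n ∸ m)
    C : Fin n → ℕ
    C i = a (suc (toℕ i)) ℕ.* B ((n ∸ toℕ i) ℕ.+ (n ∸ toℕ i))
    earlier-term : ∀ {m} → m < n → T m ≡ + (a (suc m) ℕ.* B ((n ∸ m) ℕ.+ (n ∸ m)))
    earlier-term {m} m<n = trans (cong (+ a (suc m) *_) (bellSeries-pos B (m<n⇒0<n∸m m<n)))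
                                 (sym (ℤ.pos-* (a (suc m)) (B ((n ∸ m) ℕ.+ (n ∸ m)))))
    last-term : T n ≡ + a (suc n)
    last-term = trans (cong (λ m → + a (suc n) * bellSeries B m) (n∸n≡0 n)) (ℤ.*-identityʳ _)

open PowerSeries using (bellSeries-recurrence; geometric-inverse-unique)
-- Opened only now, so that they do not clash with the integer operations inside PowerSeries.
open import Data.Nat using (_+_; _*_)

variable
  X Y : Set
  P Q : X → Set
  c d k l m n : ℕ

-- NumberOf {n} is Count at X = Rel n.
Count : {X : Set} → (X → Set) → ℕ → Set
Count {X} P c = Σ (List X) λ xs → Unique xs × (∀ x → x ∈ xs ⇔ P x) × length xs ≡ c

count-unique : Count P c → Count Q d → (∀ x → P x ⇔ Q x) → c ≡ d
count-unique (xs , xs! , xs⇔P , refl) (ys , ys! , ys⇔Q , refl) P⇔Q =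
  ↭-length (∼bag⇒↭ (unique∧set⇒bag xs! ys! λ {x} →
    ⇔.trans (xs⇔P x) (⇔.trans (P⇔Q x) (⇔.sym (ys⇔Q x)))))

count-cong : (∀ x → P x ⇔ Q x) → Count P c → Count Q c
count-cong P⇔Q (xs , xs! , xs⇔P , ∣xs∣) = xs , xs! , (λ x → ⇔.trans (xs⇔P x) (P⇔Q x)) , ∣xs∣

count-∅ : (∀ x → ¬ P x) → Count P 0
count-∅ ¬P = [] , [] , (λ x → mk⇔ (λ ()) (λ p → contradiction p (¬P x))) , refl

count-⊎ : Count P c → Count Q d → (∀ x → P x → ¬ Q x) → Count (λ x → P x ⊎ Q x) (c + d)
count-⊎ {P = P} {Q = Q} (xs , xs! , xs⇔P , refl) (ys , ys! , ys⇔Q , refl) P∩Q=∅ =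
  xs ++ ys ,
  ++⁺ xs! ys! (λ (x∈xs , x∈ys) → P∩Q=∅ _ (to (xs⇔P _) x∈xs) (to (ys⇔Q _) x∈ys)) ,
  (λ x → mk⇔ (membership x ∘ ∈-++⁻ xs)
              λ { (inj₁ p) → ∈-++⁺ˡ (from (xs⇔P x) p) ; (inj₂ q) → ∈-++⁺ʳ xs (from (ys⇔Q x) q) }) ,
  length-++ xs
  where
  open Equivalence
  membership : ∀ x → x ∈ xs ⊎ x ∈ ys → P x ⊎ Q x
  membership x (inj₁ x∈xs) = inj₁ (to (xs⇔P x) x∈xs)
  membership x (inj₂ x∈ys) = inj₂ (to (ys⇔Q x) x∈ys)

count-∃-Fin : ∀ {t} {Q : Fin t → X → Set} {c : Fin t → ℕ} →
  (∀ i → Count (Q i) (c i)) → (∀ {i j x} → Q i x → Q j x → i ≡ j) →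
  Count (λ x → ∃ λ i → Q i x) (sum c)
count-∃-Fin {t = zero}  _     _          = count-∅ λ _ ()
count-∃-Fin {t = suc t} count Q-disjoint =
  count-cong (λ _ → ⊎⇔∃)
    (count-⊎ (count Fin.zero) (count-∃-Fin (count ∘ Fin.suc) (λ qᵢ qⱼ → suc-injective (Q-disjoint qᵢ qⱼ)))
             λ { _ q₀ (j , qⱼ) → case Q-disjoint q₀ qⱼ of λ () })

length-cartesianProduct : (xs : List X) (ys : List Y) →
  length (cartesianProduct xs ys) ≡ length xs * length ys
length-cartesianProduct []       ys = refl
length-cartesianProduct (x ∷ xs) ys = begin
  length (map (x ,_) ys ++ cartesianProduct xs ys)         ≡⟨ length-++ (map (x ,_) ys) ⟩
  length (map (x ,_) ys) + length (cartesianProduct xs ys) ≡⟨ cong₂ _+_ (length-map (x ,_) ys)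
                                                                         (length-cartesianProduct xs ys) ⟩
  length ys + length xs * length ys                        ∎
  where open ≡-Reasoning

count-× : {Q : Y → Set} → Count P c → Count Q d → Count (λ z → P (proj₁ z) × Q (proj₂ z)) (c * d)
count-× (xs , xs! , xs⇔P , refl) (ys , ys! , ys⇔Q , refl) =
  cartesianProduct xs ys ,
  cartesianProduct⁺ xs! ys! ,
  (λ (x , y) → mk⇔ (λ xy∈ → let x∈ , y∈ = ∈-cartesianProduct⁻ xs ys xy∈
                            in to (xs⇔P x) x∈ , to (ys⇔Q y) y∈)
                   (λ (p , q) → ∈-cartesianProduct⁺ (from (xs⇔P x) p) (from (ys⇔Q y) q))) ,
  length-cartesianProduct xs ys
  where open Equivalence

count-image : (f : X → Y) → (∀ {x y} → f x ≡ f y → x ≡ y) →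
  Count P c → Count (λ y → ∃ λ x → P x × f x ≡ y) c
count-image f f-injective (xs , xs! , xs⇔P , refl) =
  map f xs ,
  map⁺ f-injective xs! ,
  (λ y → mk⇔ (λ y∈ → let x , x∈ , y≡fx = ∈-map⁻ f y∈ in x , to (xs⇔P x) x∈ , sym y≡fx)
             (λ { (x , p , refl) → ∈-map⁺ f (from (xs⇔P x) p) })) ,
  length-map f xs
  where open Equivalence

rel-tabulate : (f : Fin n → Fin n → Bool) → ∀ p q → rel (tabulate λ p → tabulate (f p)) p q ≡ f p q
rel-tabulate f p q = trans (cong (λ row → lookup row q) (lookup∘tabulate (λ p → tabulate (f p)) p))
                           (lookup∘tabulate (f p) q)

rel-ext : {R S : Rel n} → (∀ p q → rel R p q ≡ rel S p q) → R ≡ S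
rel-ext {R = R} {S} R≗S = begin
  R                             ≡⟨ tabulate∘lookup R ⟨
  tabulate (λ p → lookup R p)   ≡⟨ tabulate-cong row-ext ⟩
  tabulate (λ p → lookup S p)   ≡⟨ tabulate∘lookup S ⟩
  S                             ∎
  where
  open ≡-Reasoning
  row-ext : ∀ p → lookup R p ≡ lookup S p
  row-ext p = trans (sym (tabulate∘lookup (lookup R p)))
                    (trans (tabulate-cong (R≗S p)) (tabulate∘lookup (lookup S p)))

-- Points are indexed by (row, column) rather than by Fin (k + k), from which k cannot be inferred.
Point : ℕ → Set
Point k = Bool × Fin k

⟦_⟧ : Point k → Fin (k + k)
⟦ s , c ⟧ = point s c

link : Diag k → Point k → Point k → Bool
link π x y = rel π ⟦ x ⟧ ⟦ y ⟧

side-point : (x : Point k) → side ⟦ x ⟧ ≡ x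
side-point {k} (true  , c) rewrite splitAt-↑ˡ k c k = refl
side-point {k} (false , c) rewrite splitAt-↑ʳ k k c = refl

point-side : (p : Fin (k + k)) → ⟦ side {k} p ⟧ ≡ p
point-side {k} p with splitAt k p in eq
... | inj₁ c = splitAt⁻¹-↑ˡ eq
... | inj₂ c = splitAt⁻¹-↑ʳ eq

rel≡link : (π : Diag k) → ∀ p q → rel π p q ≡ link π (side {k} p) (side {k} q)
rel≡link {k} π p q = sym (cong₂ (rel π) (point-side {k} p) (point-side {k} q))

link-ext : {π σ : Diag k} → (∀ x y → link π x y ≡ link σ x y) → π ≡ σ
link-ext {k} {π} {σ} π≗σ = rel-ext {k + k} λ p q → begin
  rel π p q                          ≡⟨ rel≡link {k} π p q ⟩
  link π (side {k} p) (side {k} q)   ≡⟨ π≗σ (side {k} p) (side {k} q) ⟩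
  link σ (side {k} p) (side {k} q)   ≡⟨ rel≡link {k} σ p q ⟨
  rel σ p q                          ∎
  where open ≡-Reasoning

link-tabulate : (f : Point k → Point k → Bool) → ∀ x y →
  link (tabulate λ p → tabulate λ q → f (side {k} p) (side {k} q)) x y ≡ f x y
link-tabulate {k} f x y =
  trans (rel-tabulate (λ p q → f (side {k} p) (side {k} q)) ⟦ x ⟧ ⟦ y ⟧) (cong₂ f (side-point x) (side-point y))

embedˡ : ∀ l → Point k → Point (k + l)
embedˡ l (s , c) = s , c ↑ˡ l

embedʳ : ∀ k → Point l → Point (k + l)
embedʳ k (s , c) = s , k ↑ʳ c

data Summand {k l : ℕ} : Point (k + l) → Set where
  inˡ : (x : Point k) → Summand (embedˡ l x)
  inʳ : (x : Point l) → Summand (embedʳ k x)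

summand : (x : Point (k + l)) → Summand {k} {l} x
summand {k} (s , c) with splitAt k c in eq
... | inj₁ c₁ = subst (Summand ∘ (s ,_)) (splitAt⁻¹-↑ˡ eq) (inˡ (s , c₁))
... | inj₂ c₂ = subst (Summand ∘ (s ,_)) (splitAt⁻¹-↑ʳ eq) (inʳ (s , c₂))

toSum : Point (k + l) → Point k ⊎ Point l
toSum {k} (s , c) = Sum.map (s ,_) (s ,_) (splitAt k c)

toSum-embedˡ : (x : Point k) → toSum {k} {l} (embedˡ l x) ≡ inj₁ x
toSum-embedˡ {k} {l} (s , c) rewrite splitAt-↑ˡ k c l = refl

toSum-embedʳ : (x : Point l) → toSum {k} {l} (embedʳ k x) ≡ inj₂ x
toSum-embedʳ {l} {k} (s , c) rewrite splitAt-↑ʳ k l c = refl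

_⊕_ : (X → X → Bool) → (Y → Y → Bool) → X ⊎ Y → X ⊎ Y → Bool
(R ⊕ S) (inj₁ x) (inj₁ y) = R x y
(R ⊕ S) (inj₂ x) (inj₂ y) = S x y
(R ⊕ S) _        _        = false

⊗-link : (ρ₁ : Diag k) (ρ₂ : Diag l) (x y : Point (k + l)) →
  link (_⊗_ {k} {l} ρ₁ ρ₂) x y ≡ (link {k} ρ₁ ⊕ link {l} ρ₂) (toSum {k} {l} x) (toSum {k} {l} y)
⊗-link {k} {l} ρ₁ ρ₂ x@(s , c) y@(t , d)
  rewrite rel-tabulate (tensorRel {k} {l} ρ₁ ρ₂) ⟦ x ⟧ ⟦ y ⟧ | side-point x | side-point y
  with splitAt k c | splitAt k d
... | inj₁ _ | inj₁ _ = refl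
... | inj₁ _ | inj₂ _ = refl
... | inj₂ _ | inj₁ _ = refl
... | inj₂ _ | inj₂ _ = refl

module _ {k l : ℕ} (ρ₁ : Diag k) (ρ₂ : Diag l) where

  private
    ⊗-link-toSum : ∀ x y u v → toSum {k} {l} x ≡ u → toSum {k} {l} y ≡ v →
      link (_⊗_ {k} {l} ρ₁ ρ₂) x y ≡ (link {k} ρ₁ ⊕ link {l} ρ₂) u v
    ⊗-link-toSum x y _ _ refl refl = ⊗-link {k} {l} ρ₁ ρ₂ x y

  ⊗-linkˡˡ : (x y : Point k) → link (_⊗_ {k} {l} ρ₁ ρ₂) (embedˡ l x) (embedˡ l y) ≡ link ρ₁ x y
  ⊗-linkˡˡ x y = ⊗-link-toSum _ _ _ _ (toSum-embedˡ x) (toSum-embedˡ y)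

  ⊗-linkʳʳ : (x y : Point l) → link (_⊗_ {k} {l} ρ₁ ρ₂) (embedʳ k x) (embedʳ k y) ≡ link ρ₂ x y
  ⊗-linkʳʳ x y = ⊗-link-toSum _ _ _ _ (toSum-embedʳ x) (toSum-embedʳ y)

  ⊗-linkˡʳ : (x : Point k) (y : Point l) → link (_⊗_ {k} {l} ρ₁ ρ₂) (embedˡ l x) (embedʳ k y) ≡ false
  ⊗-linkˡʳ x y = ⊗-link-toSum _ _ _ _ (toSum-embedˡ x) (toSum-embedʳ y)

  ⊗-linkʳˡ : (x : Point l) (y : Point k) → link (_⊗_ {k} {l} ρ₁ ρ₂) (embedʳ k x) (embedˡ l y) ≡ false
  ⊗-linkʳˡ x y = ⊗-link-toSum _ _ _ _ (toSum-embedʳ x) (toSum-embedˡ y)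

IsEquivalenceᵇ : (X → X → Bool) → Set
IsEquivalenceᵇ R =
  (∀ x → R x x ≡ true) ×
  (∀ x y → R x y ≡ true → R y x ≡ true) ×
  (∀ x y z → R x y ≡ true → R y z ≡ true → R x z ≡ true)

isEquivalenceᵇ-on : {R : Y → Y → Bool} (f : X → Y) → IsEquivalenceᵇ R → IsEquivalenceᵇ (λ x y → R (f x) (f y))
isEquivalenceᵇ-on f (r , s , t) = (λ x → r (f x)) , (λ x y → s (f x) (f y)) , (λ x y z → t (f x) (f y) (f z))

isEquivalenceᵇ-resp : {R S : X → X → Bool} → (∀ x y → R x y ≡ S x y) → IsEquivalenceᵇ R → IsEquivalenceᵇ S
isEquivalenceᵇ-resp {R = R} {S} R≗S (r , s , t) =
  (λ x → to (r x)) , (λ x y Sxy → to (s x y (from Sxy))) , (λ x y z Sxy Syz → to (t x y z (from Sxy) (from Syz)))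
  where
  to : ∀ {x y} → R x y ≡ true → S x y ≡ true
  to {x} {y} = trans (sym (R≗S x y))
  from : ∀ {x y} → S x y ≡ true → R x y ≡ true
  from {x} {y} = trans (R≗S x y)

⊕-isEquivalenceᵇ : {R : X → X → Bool} {S : Y → Y → Bool} →
  IsEquivalenceᵇ R → IsEquivalenceᵇ S → IsEquivalenceᵇ (R ⊕ S)
⊕-isEquivalenceᵇ {R = R} {S} (reflᴿ , symᴿ , transᴿ) (reflˢ , symˢ , transˢ) = refl⊕ , sym⊕ , trans⊕
  where
  refl⊕ : ∀ u → (R ⊕ S) u u ≡ true
  refl⊕ (inj₁ x) = reflᴿ x
  refl⊕ (inj₂ x) = reflˢ x
  sym⊕ : ∀ u v → (R ⊕ S) u v ≡ true → (R ⊕ S) v u ≡ true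
  sym⊕ (inj₁ x) (inj₁ y) = symᴿ x y
  sym⊕ (inj₂ x) (inj₂ y) = symˢ x y
  sym⊕ (inj₁ _) (inj₂ _) ()
  sym⊕ (inj₂ _) (inj₁ _) ()
  trans⊕ : ∀ u v w → (R ⊕ S) u v ≡ true → (R ⊕ S) v w ≡ true → (R ⊕ S) u w ≡ true
  trans⊕ (inj₁ x) (inj₁ y) (inj₁ z) = transᴿ x y z
  trans⊕ (inj₂ x) (inj₂ y) (inj₂ z) = transˢ x y z
  trans⊕ (inj₁ _) (inj₁ _) (inj₂ _) _ ()
  trans⊕ (inj₂ _) (inj₂ _) (inj₁ _) _ ()
  trans⊕ (inj₁ _) (inj₂ _) _ ()
  trans⊕ (inj₂ _) (inj₁ _) _ ()

falseᵇ-sym : {R : X → X → Bool} → IsEquivalenceᵇ R → ∀ {x y} → R y x ≡ false → R x y ≡ false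
falseᵇ-sym {R = R} (_ , s , _) {x} {y} Ryx≡false with R x y in Rxy
... | false = refl
... | true  = contradiction (trans (sym (s x y Rxy)) Ryx≡false) λ ()

isSetPartition⇒link : {π : Diag k} → IsSetPartition π → IsEquivalenceᵇ (link {k} π)
isSetPartition⇒link {k} = isEquivalenceᵇ-on (⟦_⟧ {k})

link⇒isSetPartition : {π : Diag k} → IsEquivalenceᵇ (link {k} π) → IsSetPartition π
link⇒isSetPartition {k} {π} E =
  isEquivalenceᵇ-resp (λ p q → sym (rel≡link {k} π p q)) (isEquivalenceᵇ-on (side {k}) E)

⊗-isSetPartition : {ρ₁ : Diag k} {ρ₂ : Diag l} →
  IsSetPartition ρ₁ → IsSetPartition ρ₂ → IsSetPartition (_⊗_ {k} {l} ρ₁ ρ₂)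
⊗-isSetPartition {k} {l} {ρ₁} {ρ₂} P₁ P₂ = link⇒isSetPartition {k + l} {_⊗_ {k} {l} ρ₁ ρ₂}
  (isEquivalenceᵇ-resp (λ x y → sym (⊗-link {k} {l} ρ₁ ρ₂ x y))
    (isEquivalenceᵇ-on (toSum {k} {l})
      (⊕-isEquivalenceᵇ (isSetPartition⇒link {k} {ρ₁} P₁) (isSetPartition⇒link {l} {ρ₂} P₂))))

restrictˡ : ∀ {k} l → Diag (k + l) → Diag k
restrictˡ {k} l π = tabulate λ p → tabulate λ q → link π (embedˡ l (side {k} p)) (embedˡ l (side {k} q))

restrictʳ : ∀ k {l} → Diag (k + l) → Diag l
restrictʳ k {l} π = tabulate λ p → tabulate λ q → link π (embedʳ k (side {l} p)) (embedʳ k (side {l} q))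

link-restrictˡ : (π : Diag (k + l)) (x y : Point k) →
  link (restrictˡ {k} l π) x y ≡ link π (embedˡ l x) (embedˡ l y)
link-restrictˡ {k} {l} π = link-tabulate {k} λ x y → link π (embedˡ l x) (embedˡ l y)

link-restrictʳ : (π : Diag (k + l)) (x y : Point l) →
  link (restrictʳ k {l} π) x y ≡ link π (embedʳ k x) (embedʳ k y)
link-restrictʳ {k} {l} π = link-tabulate {l} λ x y → link π (embedʳ k x) (embedʳ k y)

restrictˡ-isSetPartition : {π : Diag (k + l)} → IsSetPartition π → IsSetPartition (restrictˡ {k} l π)
restrictˡ-isSetPartition {k} {l} {π} P = link⇒isSetPartition {k} {restrictˡ {k} l π}
  (isEquivalenceᵇ-resp (λ x y → sym (link-restrictˡ {k} {l} π x y))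
    (isEquivalenceᵇ-on (embedˡ l) (isSetPartition⇒link {k + l} {π} P)))

restrictʳ-isSetPartition : {π : Diag (k + l)} → IsSetPartition π → IsSetPartition (restrictʳ k {l} π)
restrictʳ-isSetPartition {k} {l} {π} P = link⇒isSetPartition {l} {restrictʳ k {l} π}
  (isEquivalenceᵇ-resp (λ x y → sym (link-restrictʳ {k} {l} π x y))
    (isEquivalenceᵇ-on (embedʳ k) (isSetPartition⇒link {k + l} {π} P)))

restrictˡ-⊗ : (ρ₁ : Diag k) (ρ₂ : Diag l) → restrictˡ {k} l (_⊗_ {k} {l} ρ₁ ρ₂) ≡ ρ₁
restrictˡ-⊗ {k} {l} ρ₁ ρ₂ = link-ext {k} λ x y →
  trans (link-restrictˡ {k} {l} (_⊗_ {k} {l} ρ₁ ρ₂) x y) (⊗-linkˡˡ {k} {l} ρ₁ ρ₂ x y)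

restrictʳ-⊗ : (ρ₁ : Diag k) (ρ₂ : Diag l) → restrictʳ k {l} (_⊗_ {k} {l} ρ₁ ρ₂) ≡ ρ₂
restrictʳ-⊗ {k} {l} ρ₁ ρ₂ = link-ext {l} λ x y →
  trans (link-restrictʳ {k} {l} (_⊗_ {k} {l} ρ₁ ρ₂) x y) (⊗-linkʳʳ {k} {l} ρ₁ ρ₂ x y)

SplitsAt : ∀ k → Diag k → ℕ → Set
SplitsAt k π j = ∀ (x y : Point k) → toℕ (proj₂ x) < j → j ≤ toℕ (proj₂ y) → link π x y ≡ false

module _ {k l : ℕ} (ρ₁ : Diag k) (ρ₂ : Diag l) where

  ⊗-splitsAt : SplitsAt (k + l) (_⊗_ {k} {l} ρ₁ ρ₂) k
  ⊗-splitsAt x y x<k k≤y with summand {k} {l} x | summand {k} {l} y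
  ... | inˡ x       | inˡ (_ , d) = contradiction (toℕ<n d) (≤⇒≯ (subst (k ≤_) (toℕ-↑ˡ d l) k≤y))
  ... | inˡ x       | inʳ y       = ⊗-linkˡʳ {k} {l} ρ₁ ρ₂ x y
  ... | inʳ (_ , c) | _           = contradiction (subst (_< k) (toℕ-↑ʳ k c) x<k) (m+n≮m k _)

  splitsAt-⊗⁻ : ∀ {j} → SplitsAt (k + l) (_⊗_ {k} {l} ρ₁ ρ₂) j → SplitsAt k ρ₁ j
  splitsAt-⊗⁻ {j} split x@(_ , c) y@(_ , d) x<j j≤y = begin
    link ρ₁ x y                                        ≡⟨ ⊗-linkˡˡ {k} {l} ρ₁ ρ₂ x y ⟨
    link (_⊗_ {k} {l} ρ₁ ρ₂) (embedˡ l x) (embedˡ l y) ≡⟨ split (embedˡ l x) (embedˡ l y)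
                                                            (subst (_< j) (sym (toℕ-↑ˡ c l)) x<j)
                                                            (subst (j ≤_) (sym (toℕ-↑ˡ d l)) j≤y) ⟩
    false                                              ∎
    where open ≡-Reasoning

  splitsAt-⊗⁺ : ∀ {j} → j ≤ k → SplitsAt k ρ₁ j → SplitsAt (k + l) (_⊗_ {k} {l} ρ₁ ρ₂) j
  splitsAt-⊗⁺ {j} j≤k split x y x<j j≤y with summand {k} {l} x | summand {k} {l} y
  ... | inˡ x@(_ , c) | inˡ y@(_ , d) = trans (⊗-linkˡˡ {k} {l} ρ₁ ρ₂ x y)
                                          (split x y (subst (_< j) (toℕ-↑ˡ c l) x<j) (subst (j ≤_) (toℕ-↑ˡ d l) j≤y))
  ... | inˡ x         | inʳ y         = ⊗-linkˡʳ {k} {l} ρ₁ ρ₂ x y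
  ... | inʳ (_ , c)   | _             = contradiction (<-≤-trans (subst (_< j) (toℕ-↑ʳ k c) x<j) j≤k) (m+n≮m k _)

⊗-restrict : (π : Diag (k + l)) → IsSetPartition π → SplitsAt (k + l) π k →
  _⊗_ {k} {l} (restrictˡ {k} l π) (restrictʳ k {l} π) ≡ π
⊗-restrict {k} {l} π P split = link-ext {k + l} λ x y → entry x y (summand {k} {l} x) (summand {k} {l} y)
  where
  ρ₁ : Diag k
  ρ₁ = restrictˡ {k} l π
  ρ₂ : Diag l
  ρ₂ = restrictʳ k {l} π
  left<k : (x : Point k) → toℕ (proj₂ (embedˡ l x)) < k
  left<k (_ , c) = subst (_< k) (sym (toℕ-↑ˡ c l)) (toℕ<n c)
  k≤right : (y : Point l) → k ≤ toℕ (proj₂ (embedʳ k y))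
  k≤right (_ , d) = subst (k ≤_) (sym (toℕ-↑ʳ k d)) (m≤m+n k _)
  entry : ∀ x y → Summand x → Summand y → link (_⊗_ {k} {l} ρ₁ ρ₂) x y ≡ link π x y
  entry _ _ (inˡ x) (inˡ y) = trans (⊗-linkˡˡ {k} {l} ρ₁ ρ₂ x y) (link-restrictˡ {k} {l} π x y)
  entry _ _ (inʳ x) (inʳ y) = trans (⊗-linkʳʳ {k} {l} ρ₁ ρ₂ x y) (link-restrictʳ {k} {l} π x y)
  entry _ _ (inˡ x) (inʳ y) = trans (⊗-linkˡʳ {k} {l} ρ₁ ρ₂ x y)
    (sym (split (embedˡ l x) (embedʳ k y) (left<k x) (k≤right y)))
  entry _ _ (inʳ x) (inˡ y) = trans (⊗-linkʳˡ {k} {l} ρ₁ ρ₂ x y)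
    (sym (falseᵇ-sym (isSetPartition⇒link {k + l} {π} P) {embedʳ k x} {embedˡ l y}
      (split (embedˡ l y) (embedʳ k x) (left<k y) (k≤right x))))

-- A factorisation exactly as it appears in the definition of Irreducible.
glue : k + l ≡ n → Diag k → Diag l → Diag n
glue {k} {l} e ρ₁ ρ₂ = subst Diag e (_⊗_ {k} {l} ρ₁ ρ₂)

Glued : k + l ≡ n → (Diag k → Set) → (Diag l → Set) → Diag n → Set
Glued {k} {l} e P Q π = ∃ λ (ρ : Diag k × Diag l) → (P (proj₁ ρ) × Q (proj₂ ρ)) × uncurry (glue {k} {l} e) ρ ≡ π

glue-injective : (e : k + l ≡ n) {ρ σ : Diag k × Diag l} →
  uncurry (glue {k} {l} e) ρ ≡ uncurry (glue {k} {l} e) σ → ρ ≡ σ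
glue-injective {k} {l} refl {ρ₁ , ρ₂} {σ₁ , σ₂} eq = cong₂ _,_
  (trans (sym (restrictˡ-⊗ {k} {l} ρ₁ ρ₂)) (trans (cong (restrictˡ {k} l) eq) (restrictˡ-⊗ {k} {l} σ₁ σ₂)))
  (trans (sym (restrictʳ-⊗ {k} {l} ρ₁ ρ₂)) (trans (cong (restrictʳ k {l}) eq) (restrictʳ-⊗ {k} {l} σ₁ σ₂)))

glue-isSetPartition : (e : k + l ≡ n) {ρ₁ : Diag k} {ρ₂ : Diag l} →
  IsSetPartition ρ₁ → IsSetPartition ρ₂ → IsSetPartition (glue {k} {l} e ρ₁ ρ₂)
glue-isSetPartition {k} {l} refl = ⊗-isSetPartition {k} {l}

glue-splitsAt : (e : k + l ≡ n) (ρ₁ : Diag k) (ρ₂ : Diag l) → SplitsAt n (glue {k} {l} e ρ₁ ρ₂) k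
glue-splitsAt {k} {l} refl ρ₁ ρ₂ = ⊗-splitsAt {k} {l} ρ₁ ρ₂

splitsAt-glue⁻ : ∀ {j} (e : k + l ≡ n) (ρ₁ : Diag k) (ρ₂ : Diag l) →
  SplitsAt n (glue {k} {l} e ρ₁ ρ₂) j → SplitsAt k ρ₁ j
splitsAt-glue⁻ {k} {l} refl ρ₁ ρ₂ = splitsAt-⊗⁻ {k} {l} ρ₁ ρ₂

splitsAt-glue⁺ : ∀ {j} (e : k + l ≡ n) (ρ₁ : Diag k) (ρ₂ : Diag l) →
  j ≤ k → SplitsAt k ρ₁ j → SplitsAt n (glue {k} {l} e ρ₁ ρ₂) j
splitsAt-glue⁺ {k} {l} refl ρ₁ ρ₂ = splitsAt-⊗⁺ {k} {l} ρ₁ ρ₂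

unglue : (e : k + l ≡ n) {π : Diag n} → IsSetPartition π → SplitsAt n π k →
  Glued {k} {l} e (IsDiagram k) (IsDiagram l) π
unglue {k} {l} refl {π} P split =
  (restrictˡ {k} l π , restrictʳ k {l} π) ,
  (restrictˡ-isSetPartition {k} {l} {π} P , restrictʳ-isSetPartition {k} {l} {π} P) ,
  ⊗-restrict π P split

irreducible⇒¬splitsAt : {π : Diag n} → IsDiagram n π → Irreducible n π →
  ∀ {j} → suc j < n → ¬ SplitsAt n π (suc j)
irreducible⇒¬splitsAt {n} P irr {j} j<n split =
  let e = m+[n∸m]≡n (<⇒≤ j<n)
      (ρ₁ , ρ₂) , (P₁ , P₂) , glued = unglue {suc j} {n ∸ suc j} e P split
  in irr (suc j , n ∸ suc j , e , ρ₁ , ρ₂ , s≤s z≤n , m<n⇒0<n∸m j<n , P₁ , P₂ , glued)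

¬splitsAt⇒irreducible : {π : Diag n} → (∀ {j} → suc j < n → ¬ SplitsAt n π (suc j)) → Irreducible n π
¬splitsAt⇒irreducible _ (zero , _ , _ , _ , _ , () , _)
¬splitsAt⇒irreducible {n} unsplit (suc k , l , e , ρ₁ , ρ₂ , _ , 0<l , _ , _ , glued) =
  unsplit (subst (suc k <_) e (m<m+n (suc k) 0<l))
          (subst (λ π → SplitsAt n π (suc k)) glued (glue-splitsAt e ρ₁ ρ₂))

IsFirstSplit : ∀ n → Diag n → ℕ → Set
IsFirstSplit n π k = SplitsAt n π k × (∀ {j} → suc j < k → ¬ SplitsAt n π (suc j))

isFirstSplit-unique : {π : Diag n} → IsFirstSplit n π (suc k) → IsFirstSplit n π (suc l) → k ≡ l
isFirstSplit-unique {k = k} {l} (splitₖ , firstₖ) (splitₗ , firstₗ) with <-cmp k l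
... | tri< k<l _ _ = contradiction splitₖ (firstₗ (s≤s k<l))
... | tri≈ _ k≡l _ = k≡l
... | tri> _ _ l<k = contradiction splitₗ (firstₖ (s≤s l<k))

IrreducibleDiagram : ∀ k → Diag k → Set
IrreducibleDiagram k π = IsDiagram k π × Irreducible k π

glued-isFirstSplit : (e : k + l ≡ n) {Q : Diag l → Set} {π : Diag n} →
  Glued {k} {l} e (IrreducibleDiagram k) Q π → IsFirstSplit n π k
glued-isFirstSplit e ((ρ₁ , ρ₂) , ((P₁ , irr) , _) , refl) =
  glue-splitsAt e ρ₁ ρ₂ , λ j<k split → irreducible⇒¬splitsAt P₁ irr j<k (splitsAt-glue⁻ e ρ₁ ρ₂ split)

firstSplit⇒glued : (e : k + l ≡ n) {π : Diag n} → IsDiagram n π → IsFirstSplit n π k →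
  Glued {k} {l} e (IrreducibleDiagram k) (IsDiagram l) π
firstSplit⇒glued {k} {n = n} e P (split , first) =
  let (ρ₁ , ρ₂) , (P₁ , P₂) , glued = unglue e P split
      irr : Irreducible k ρ₁
      irr = ¬splitsAt⇒irreducible λ j<k splitρ₁ →
        first j<k (subst (λ π → SplitsAt n π _) glued (splitsAt-glue⁺ e ρ₁ ρ₂ (<⇒≤ j<k) splitρ₁))
  in (ρ₁ , ρ₂) , ((P₁ , irr) , P₂) , glued

∀-Bool? : {P : Bool → Set} → (∀ b → Dec (P b)) → Dec (∀ b → P b)
∀-Bool? P? = map′ (λ (t , f) → λ { true → t ; false → f }) (λ h → h true , h false) (P? true ×-dec P? false)

∀-Point? : {P : Point k → Set} → (∀ x → Dec (P x)) → Dec (∀ x → P x)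
∀-Point? P? = map′ (λ h (s , c) → h s c) (λ h s c → h (s , c)) (∀-Bool? λ s → all? λ c → P? (s , c))

splitsAt? : ∀ n (π : Diag n) j → Dec (SplitsAt n π j)
splitsAt? n π j = ∀-Point? λ x → ∀-Point? λ y →
  (toℕ (proj₂ x) <? j) →-dec (j ≤? toℕ (proj₂ y)) →-dec (link π x y Bool.≟ false)

firstSplit? : (π : Diag (suc n)) →
  (∀ {j} → suc j < suc n → ¬ SplitsAt (suc n) π (suc j)) ⊎ ∃ λ (i : Fin n) → IsFirstSplit (suc n) π (suc (toℕ i))
firstSplit? {n} π with any? (λ (i : Fin n) → splitsAt? (suc n) π (suc (toℕ i)))
... | no ∄split = inj₁ λ j<n split →
  ∄split (fromℕ< (ℕ.s<s⁻¹ j<n) , subst (SplitsAt (suc n) π ∘ suc) (sym (toℕ-fromℕ< _)) split)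
... | yes (i , split) =
  let i , ¬¬split , earlier = ¬∀⟶∃¬-smallest n (λ i → ¬ SplitsAt (suc n) π (suc (toℕ i)))
                                (λ i → ¬? (splitsAt? (suc n) π (suc (toℕ i)))) (λ ∀¬split → ∀¬split i split)
  in inj₂ (i , decidable-stable (splitsAt? (suc n) π (suc (toℕ i))) ¬¬split , λ j<i split →
       earlier (fromℕ< (ℕ.s<s⁻¹ j<i))
         (subst (SplitsAt (suc n) π ∘ suc) (sym (trans (toℕ-inject _) (toℕ-fromℕ< _))) split))

factor-orders : (i : Fin n) → suc (toℕ i) + (n ∸ toℕ i) ≡ suc n
factor-orders i = cong suc (m+[n∸m]≡n (<⇒≤ (toℕ<n i)))

FirstFactor : (i : Fin n) → Diag (suc n) → Set
FirstFactor {n} i =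
  Glued {suc (toℕ i)} {n ∸ toℕ i} (factor-orders i) (IrreducibleDiagram (suc (toℕ i))) (IsDiagram (n ∸ toℕ i))

firstFactor-unique : {π : Diag (suc n)} {i j : Fin n} → FirstFactor i π → FirstFactor j π → i ≡ j
firstFactor-unique {n} {π} {i} {j} factorᵢ factorⱼ = toℕ-injective (isFirstSplit-unique {π = π}
  (glued-isFirstSplit {suc (toℕ i)} {n ∸ toℕ i} (factor-orders i) factorᵢ)
  (glued-isFirstSplit {suc (toℕ j)} {n ∸ toℕ j} (factor-orders j) factorⱼ))

irreducible-noFirstFactor : {π : Diag (suc n)} → Irreducible (suc n) π → ¬ ∃ λ i → FirstFactor i π
irreducible-noFirstFactor {n} irr (i , (ρ₁ , ρ₂) , ((P₁ , _) , P₂) , glued) =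
  irr (suc (toℕ i) , n ∸ toℕ i , factor-orders i , ρ₁ , ρ₂ , s≤s z≤n , m<n⇒0<n∸m (toℕ<n i) ,
       P₁ , P₂ , glued)

isDiagram⇔irreducible⊎firstFactor : (π : Diag (suc n)) →
  IsDiagram (suc n) π ⇔ (IrreducibleDiagram (suc n) π ⊎ ∃ λ i → FirstFactor i π)
isDiagram⇔irreducible⊎firstFactor {n} π = mk⇔ classify unclassify
  where
  classify : IsDiagram (suc n) π → IrreducibleDiagram (suc n) π ⊎ ∃ λ i → FirstFactor i π
  classify P with firstSplit? π
  ... | inj₁ unsplit     = inj₁ (P , ¬splitsAt⇒irreducible unsplit)
  ... | inj₂ (i , first) = inj₂ (i , firstSplit⇒glued {suc (toℕ i)} (factor-orders i) P first)
  unclassify : IrreducibleDiagram (suc n) π ⊎ (∃ λ i → FirstFactor i π) → IsDiagram (suc n) π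
  unclassify (inj₁ (P , _)) = P
  unclassify (inj₂ (i , (ρ₁ , ρ₂) , ((P₁ , _) , P₂) , glued)) =
    subst (IsDiagram (suc n)) glued (glue-isSetPartition {suc (toℕ i)} (factor-orders i) P₁ P₂)

bell-recurrence : {a B : ℕ → ℕ} →
  (∀ m → NumberOf (IsSetPartition {m}) (B m)) → (∀ k → 1 ≤ k → NumberOf (IrreducibleDiagram k) (a k)) →
  ∀ n → B (suc n + suc n) ≡ a (suc n) + sum (λ (i : Fin n) → a (suc (toℕ i)) * B ((n ∸ toℕ i) + (n ∸ toℕ i)))
bell-recurrence {a} {B} bell irreducibles n = count-unique (bell _)
  (count-⊎ (irreducibles (suc n) (s≤s z≤n)) (count-∃-Fin count-firstFactor firstFactor-unique)
           (λ _ (_ , irr) → irreducible-noFirstFactor irr))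
  isDiagram⇔irreducible⊎firstFactor
  where
  count-firstFactor : (i : Fin n) → Count (FirstFactor i) (a (suc (toℕ i)) * B ((n ∸ toℕ i) + (n ∸ toℕ i)))
  count-firstFactor i =
    count-image (uncurry (glue {suc (toℕ i)} (factor-orders i))) (glue-injective {suc (toℕ i)} (factor-orders i))
      (count-× (irreducibles (suc (toℕ i)) (s≤s z≤n)) (bell _))

theorem2p9 : (a B : ℕ → ℕ) →
    (∀ m → NumberOf (IsSetPartition {m}) (B m)) →
    (∀ k → 1 ≤ k → NumberOf (λ π → IsDiagram k π × Irreducible k π) (a k)) →
    (G : Series) → (∀ n → (G ⋆ bellSeries B) n ≡ oneS n) →
    ∀ n → irredSeries a n ≡ oneS n - G n
theorem2p9 a B bell irreducibles G G⋆b≡1 =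
  geometric-inverse-unique (irredSeries a) (bellSeries B) G refl refl
    (bellSeries-recurrence {a} {B} (bell-recurrence bell irreducibles)) G⋆b≡1
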